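{- Let $H$ be an instance as described in the context and let $M^*$ be an $\mathcal{A}$-perfect stable matching minimizing $\max_{p\in\mathcal{B}}|M^*(p)|\cdot c(p)$ among all $\mathcal{A}$-perfect stable matchings. Then the total cost $\sum_{p\in\mathcal{B}}|M^*(p)|c(p)$ is at most $|\mathcal{B}|$ times the minimum total cost of an $\mathcal{A}$-perfect stable matching in $H$.
   Context: An instance consists of a bipartite graph $(\mathcal{A}\cup\mathcal{B},E)$, agents $\mathcal{A}$, programs $\mathcal{B}$, $(a,p)\in E$ iff mutually acceptable. Each agent and each program ranks its neighbours in a strict order ($y>_x z$: $x$ prefers $y$ to $z$). Each program $p$ has a non-negative integer cost $c(p)$; programs have no quotas. A matching $M\subseteq E$ assigns each agent to at most one program (a program may receive any number of agents); $M(a)$, $M(p)$ denote partners. An agent prefers any acceptable program to being unmatched. A pair $(a,p)\in E\setminus M$ blocks $M$ if $p>_a M(a)$ and there is $a'\in M(p)$ with $a>_p a'$; $M$ is stable if no pair blocks it; $M$ is $\mathcal{A}$-perfect if every agent is matched. -}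

module Defs where

open import Data.Nat using (ℕ; _+_; _*_; _⊔_; _<_; _≤_)
open import Data.Fin using (Fin)
open import Data.Maybe using (Maybe; just; nothing)
open import Data.Product using (_×_; Σ; ∃; _,_)
open import Data.Empty using (⊥)
open import Data.Unit using (⊤)
open import Data.List using (List; length; filter; foldr; map)
open import Data.Nat.ListAction using () renaming (sum to lsum)
open import Data.List using (allFin)
open import Relation.Binary.PropositionalEquality using (_≡_)
open import Relation.Nullary using (¬_)
open import Data.Maybe.Properties using () renaming (≡-dec to maybe-≡-dec)
open import Data.Fin.Properties using (_≟_)
open import Function.Definitions using (Injective)

-- Strict preferences are given by rank functions: a smaller rank is better.
-- Agent a ranks programs via rankA a, program p ranks agents via rankB p;
-- injectivity makes the orders strict (and total on the neighbours).
record Instance (nA nB : ℕ) : Set₁ where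
  field
    E      : Fin nA → Fin nB → Set          -- mutual acceptability
    rankA  : Fin nA → Fin nB → ℕ
    rankB  : Fin nB → Fin nA → ℕ
    rankA-inj : ∀ a → Injective _≡_ _≡_ (rankA a)
    rankB-inj : ∀ p → Injective _≡_ _≡_ (rankB p)
    cost   : Fin nB → ℕ

module _ {nA nB : ℕ} (H : Instance nA nB) where
  open Instance H

  _>A[_]_ : Fin nB → Fin nA → Fin nB → Set
  p >A[ a ] q = rankA a p < rankA a q

  _>B[_]_ : Fin nA → Fin nB → Fin nA → Set
  a >B[ p ] b = rankB p a < rankB p b

  -- A matching assigns each agent at most one program, along edges.
  -- Programs have no quotas.
  Assignment : Set
  Assignment = Fin nA → Maybe (Fin nB)

  IsMatching : Assignment → Set
  IsMatching M = ∀ a p → M a ≡ just p → E a p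

  PrefersToPartner : Assignment → Fin nA → Fin nB → Set
  PrefersToPartner M a p with M a
  ... | nothing = ⊤
  ... | just q  = p >A[ a ] q

  Blocks : Assignment → Fin nA → Fin nB → Set
  Blocks M a p =
    E a p × ¬ (M a ≡ just p) × PrefersToPartner M a p ×
    ∃ λ a' → M a' ≡ just p × a >B[ p ] a'

  Stable : Assignment → Set
  Stable M = IsMatching M × (∀ a p → ¬ Blocks M a p)

  APerfect : Assignment → Set
  APerfect M = ∀ a → ∃ λ p → M a ≡ just p

  PerfectStable : Assignment → Set
  PerfectStable M = Stable M × APerfect M

  load : Assignment → Fin nB → ℕ
  load M p = length (filter (λ a → maybe-≡-dec _≟_ (M a) (just p)) (allFin nA))

  maxCost : Assignment → ℕ
  maxCost M = foldr _⊔_ 0 (map (λ p → load M p * cost p) (allFin nB))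

  totalCost : Assignment → ℕ
  totalCost M = lsum (map (λ p → load M p * cost p) (allFin nB))

-- The total cost of any matching lies between its maximum program cost and
-- |B| times it. Hence total(M*) ≤ |B|·max(M*) ≤ |B|·max(M) ≤ |B|·total(M),
-- the middle step being the minimality of M*; stability plays no further role.
module Submission where

open import Defs
open import Data.Nat using (ℕ; _*_; _≤_; _⊔_; z≤n)
open import Data.Nat.Properties
  using (≤-trans; ⊔-lub; m≤m⊔n; m≤n⊔m; m≤m+n; m≤n+m; +-mono-≤; *-monoʳ-≤; module ≤-Reasoning)
open import Data.Nat.ListAction using () renaming (sum to lsum)
open import Data.List using (List; []; _∷_; foldr; map; length; allFin)
open import Data.List.Properties using (length-map; length-tabulate)
open import Data.Fin using (Fin)
open import Relation.Binary.PropositionalEquality using (_≡_; trans; subst)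

max≤sum : ∀ (xs : List ℕ) → foldr _⊔_ 0 xs ≤ lsum xs
max≤sum []       = z≤n
max≤sum (x ∷ xs) = ⊔-lub (m≤m+n x _) (≤-trans (max≤sum xs) (m≤n+m _ x))

sum≤length*max : ∀ (xs : List ℕ) → lsum xs ≤ length xs * foldr _⊔_ 0 xs
sum≤length*max []       = z≤n
sum≤length*max (x ∷ xs) = +-mono-≤ (m≤m⊔n x _)
  (≤-trans (sum≤length*max xs) (*-monoʳ-≤ (length xs) (m≤n⊔m x _)))

length-map-allFin : ∀ {A : Set} n (f : Fin n → A) → length (map f (allFin n)) ≡ n
length-map-allFin n f = trans (length-map f (allFin n)) (length-tabulate {n = n} (λ i → i))

module _ {nA nB : ℕ} (H : Instance nA nB) where

  programCosts : Assignment H → List ℕ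
  programCosts M = map (λ p → load H M p * Instance.cost H p) (allFin nB)

  maxCost≤totalCost : ∀ M → maxCost H M ≤ totalCost H M
  maxCost≤totalCost M = max≤sum (programCosts M)

  totalCost≤nB*maxCost : ∀ M → totalCost H M ≤ nB * maxCost H M
  totalCost≤nB*maxCost M =
    subst (λ k → totalCost H M ≤ k * maxCost H M)
          (length-map-allFin nB _)
          (sum≤length*max (programCosts M))

lemma8 : ∀ {nA nB : ℕ} (H : Instance nA nB) (Mstar : Assignment H) →
    PerfectStable H Mstar →
    (∀ M → PerfectStable H M → maxCost H Mstar ≤ maxCost H M) →
    ∀ M → PerfectStable H M → totalCost H Mstar ≤ nB * totalCost H M
lemma8 {nB = nB} H Mstar _ minimal M perfectStable = begin
  totalCost H Mstar   ≤⟨ totalCost≤nB*maxCost H Mstar ⟩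
  nB * maxCost H Mstar ≤⟨ *-monoʳ-≤ nB (minimal M perfectStable) ⟩
  nB * maxCost H M     ≤⟨ *-monoʳ-≤ nB (maxCost≤totalCost H M) ⟩
  nB * totalCost H M   ∎
  where open ≤-Reasoning
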